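{- Let $D$ be a quasi difference set in a commutative group $\mathsf G=\langle G,\cdot,1\rangle$ satisfying: whenever $d_1,d_2,d_3,d_4\in D$ and $d_1d_2^{ -1}d_3d_4^{ -1}\in DD^{ -1}$, then $d_1d_2^{ -1}=1$ or $d_3d_4^{ -1}=1$ or $d_1d_4^{ -1}=1$ or $d_3d_2^{ -1}=1$. Then the structure $\mathbf D(\mathsf G,D)$ is Desarguesian.
   Context: For a group $\mathsf G$ and $D\subseteq G$, $\mathbf D(\mathsf G,D)$ is the incidence structure whose points are the elements of $G$ and whose lines are the translates $b\cdot D$, $b\in G$, incidence being membership. $D$ is a quasi difference set if for every $c\neq 1$ there is at most one pair $(a,b)\in D\times D$ with $ab^{ -1}=c$. $DD^{ -1}=\{xy^{ -1}\colon x,y\in D\}$. A triangle is a triple of pairwise collinear, non-collinear points. An incidence structure is Desarguesian if the following holds: whenever $L_1,L_2,L_3$ are three distinct lines through a point $o$, and $p'_i,p''_i$ are points on $L_i$ different from $o$ ($i=1,2,3$) such that $(p'_1,p'_2,p'_3)$ and $(p''_1,p''_2,p''_3)$ are triangles and, for each $\{i,j,k\}=\{1,2,3\}$, the line through $p'_i,p'_j$ and the line through $p''_i,p''_j$ meet in a point $q_k$, then $q_1,q_2,q_3$ lie on a common line. -}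

module Defs where

open import Level using (Level; _⊔_)
open import Algebra.Bundles using (AbelianGroup)
open import Data.Product using (Σ; ∃; _×_; _,_)
open import Data.Sum using (_⊎_)
open import Data.Fin using (Fin; zero; suc)
open import Relation.Nullary using (¬_)
open import Relation.Binary.PropositionalEquality using (_≡_)

module _ {c ℓ d : Level} (𝔾 : AbelianGroup c ℓ) (D : AbelianGroup.Carrier 𝔾 → Set d) where
  open AbelianGroup 𝔾

  RespectsEq : Set (c ⊔ ℓ ⊔ d)
  RespectsEq = ∀ {x y} → x ≈ y → D x → D y

  IsQuasiDifferenceSet : Set (c ⊔ ℓ ⊔ d)
  IsQuasiDifferenceSet =
    ∀ a b a' b' → D a → D b → D a' → D b' →
    ¬ (a ∙ b ⁻¹ ≈ ε) → a ∙ b ⁻¹ ≈ a' ∙ b' ⁻¹ → (a ≈ a') × (b ≈ b')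

  InDD⁻¹ : Carrier → Set (c ⊔ ℓ ⊔ d)
  InDD⁻¹ z = ∃ λ x → ∃ λ y → D x × D y × (z ≈ x ∙ y ⁻¹)

  FourCondition : Set (c ⊔ ℓ ⊔ d)
  FourCondition =
    ∀ d₁ d₂ d₃ d₄ → D d₁ → D d₂ → D d₃ → D d₄ →
    InDD⁻¹ (d₁ ∙ d₂ ⁻¹ ∙ d₃ ∙ d₄ ⁻¹) →
    (d₁ ∙ d₂ ⁻¹ ≈ ε) ⊎ (d₃ ∙ d₄ ⁻¹ ≈ ε) ⊎ (d₁ ∙ d₄ ⁻¹ ≈ ε) ⊎ (d₃ ∙ d₂ ⁻¹ ≈ ε)

  -- Incidence structure D(G,D): points are elements of G, lines are translates b·D
  -- (a line is named by a translating element b; line equality is equality of point sets)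
  OnLine : Carrier → Carrier → Set (c ⊔ ℓ ⊔ d)
  OnLine x b = ∃ λ e → D e × (x ≈ b ∙ e)

  SameLine : Carrier → Carrier → Set (c ⊔ ℓ ⊔ d)
  SameLine b b' = ∀ x → (OnLine x b → OnLine x b') × (OnLine x b' → OnLine x b)

  Collinear₂ : Carrier → Carrier → Set (c ⊔ ℓ ⊔ d)
  Collinear₂ x y = ∃ λ b → OnLine x b × OnLine y b

  Collinear₃ : Carrier → Carrier → Carrier → Set (c ⊔ ℓ ⊔ d)
  Collinear₃ x y z = ∃ λ b → OnLine x b × OnLine y b × OnLine z b

  Triangle : Carrier → Carrier → Carrier → Set (c ⊔ ℓ ⊔ d)
  Triangle x y z = Collinear₂ x y × Collinear₂ y z × Collinear₂ x z × ¬ Collinear₃ x y z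

  LinesMeetIn : Carrier → Carrier → Carrier → Carrier → Carrier → Set (c ⊔ ℓ ⊔ d)
  LinesMeetIn x y x' y' q =
    ∃ λ b → ∃ λ b' → OnLine x b × OnLine y b × OnLine x' b' × OnLine y' b' ×
      ¬ SameLine b b' × OnLine q b × OnLine q b'

  Desarguesian : Set (c ⊔ ℓ ⊔ d)
  Desarguesian =
    ∀ (o : Carrier) (L p′ p″ q : Fin 3 → Carrier) →
    (∀ i j → ¬ (i ≡ j) → ¬ SameLine (L i) (L j)) →
    (∀ i → OnLine o (L i)) →
    (∀ i → OnLine (p′ i) (L i) × OnLine (p″ i) (L i)) →
    (∀ i → ¬ (p′ i ≈ o) × ¬ (p″ i ≈ o)) →
    Triangle (p′ zero) (p′ (suc zero)) (p′ (suc (suc zero))) →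
    Triangle (p″ zero) (p″ (suc zero)) (p″ (suc (suc zero))) →
    (∀ i j k → ¬ (i ≡ j) → ¬ (j ≡ k) → ¬ (i ≡ k) →
       LinesMeetIn (p′ i) (p′ j) (p″ i) (p″ j) (q k)) →
    Collinear₃ (q zero) (q (suc zero)) (q (suc (suc zero)))

module Submission where

-- A point x lies on the line b·D iff x ≈ b·e for some e ∈ D (its coordinate).
-- Two facts about D(G,D) carry the argument:
--   * labelUnique (quasi difference set): two distinct points lie on at most
--     one line, i.e. the translating element b is determined;
--   * triangleLaw (four-element condition): if P,R lie on m, R,Q lie on l and
--     P,Q are collinear but P,Q,R are not, then P·l ≈ Q·m.  The coordinate
--     quotients of the three sides multiply to an element of DD⁻¹, and the
--     four-element condition leaves only the case in which P and Q have the
--     same coordinate.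
-- Applied to a pencil of two lines a, b through the centre o, the triangle law
-- shows that the meeting point q of the sides x′y′ and x″y″ of two perspective
-- triangles satisfies q·a·o ≈ x′·x″·b (meetPoint).  For the three meeting points
-- of Desargues' configuration this gives q_k·L_k·o ≈ κ′·κ″·L₀L₁L₂ for all k,
-- where κ′, κ″ are the common coordinates of the two triangles; hence every
-- q_k lies on the line (κ′κ″L₀L₁L₂/o²)·D.

open import Defs
open import Level using (Level; _⊔_)
open import Algebra.Bundles using (AbelianGroup; Group)
open import Data.Product using (_×_; _,_; proj₁; proj₂; swap)
open import Data.Sum using (_⊎_; inj₁; inj₂)
open import Data.Fin using (Fin; zero; suc)
open import Data.Empty using (⊥; ⊥-elim)
open import Relation.Nullary using (¬_)
open import Relation.Binary.PropositionalEquality using (_≡_)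
import Algebra.Properties.AbelianGroup as AbelianGroupProperties
import Algebra.Properties.CommutativeSemigroup as CommutativeSemigroupProperties
import Algebra.Solver.CommutativeMonoid as CommutativeMonoidSolver
import Relation.Binary.Reasoning.Setoid as SetoidReasoning

module GroupFacts {c ℓ : Level} (𝔾 : AbelianGroup c ℓ) where
  open AbelianGroup 𝔾
  open Group group public using (_//_)
  open AbelianGroupProperties 𝔾 public
    using (∙-cancelʳ; x∙y⁻¹≈ε⇒x≈y; ⁻¹-∙-comm; //-cong₂; \\-leftDividesʳ; //-rightDividesˡ)
  open CommutativeSemigroupProperties commutativeSemigroup public
    using (interchange; xy∙z≈y∙xz; xy∙z≈x∙zy; xy∙z≈xz∙y; xy∙z≈zy∙x; xy∙z≈z∙xy)
  open CommutativeMonoidSolver commutativeMonoid using (solve; _⊜_; _⊕_)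
  open SetoidReasoning setoid

  quotientOnLine : ∀ {x y b e f} → x ≈ b ∙ e → y ≈ b ∙ f → x // y ≈ e // f
  quotientOnLine {x} {y} {b} {e} {f} x≈be y≈bf = begin
    x // y                     ≈⟨ //-cong₂ x≈be y≈bf ⟩
    (b ∙ e) ∙ (b ∙ f) ⁻¹       ≈⟨ ∙-congˡ (sym (⁻¹-∙-comm b f)) ⟩
    (b ∙ e) ∙ (b ⁻¹ ∙ f ⁻¹)    ≈⟨ interchange b e (b ⁻¹) (f ⁻¹) ⟩
    (b ∙ b ⁻¹) ∙ (e // f)      ≈⟨ ∙-congʳ (inverseʳ b) ⟩
    ε ∙ (e // f)               ≈⟨ identityˡ (e // f) ⟩
    e // f                     ∎

  coincide : ∀ {x y b e f} → x ≈ b ∙ e → y ≈ b ∙ f → e // f ≈ ε → x ≈ y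
  coincide x≈be y≈bf e/f≈ε = trans x≈be (trans (∙-congˡ (x∙y⁻¹≈ε⇒x≈y _ _ e/f≈ε)) (sym y≈bf))

  cancelCoordinate : ∀ {x a b e f} → x ≈ a ∙ e → x ≈ b ∙ f → e ≈ f → a ≈ b
  cancelCoordinate {a = a} {b} {e} x≈ae x≈bf e≈f =
    ∙-cancelʳ e a b (trans (sym x≈ae) (trans x≈bf (∙-congˡ (sym e≈f))))

  sameCoordinate : ∀ {x y a b e} → x ≈ a ∙ e → y ≈ b ∙ e → x ∙ b ≈ y ∙ a
  sameCoordinate {x} {y} {a} {b} {e} x≈ae y≈be = begin
    x ∙ b        ≈⟨ ∙-congʳ x≈ae ⟩
    a ∙ e ∙ b    ≈⟨ xy∙z≈zy∙x a e b ⟩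
    b ∙ e ∙ a    ≈⟨ ∙-congʳ (sym y≈be) ⟩
    y ∙ a        ∎

  telescope : ∀ x y z → (x // y) ∙ (y // z) ≈ x // z
  telescope x y z = begin
    (x // y) ∙ (y // z)           ≈⟨ assoc x (y ⁻¹) (y // z) ⟩
    x ∙ (y ⁻¹ ∙ (y ∙ z ⁻¹))       ≈⟨ ∙-congˡ (\\-leftDividesʳ y (z ⁻¹)) ⟩
    x // z                        ∎

  crossToQuotient : ∀ {x y a b} → x ∙ b ≈ y ∙ a → x // a ≈ y // b
  crossToQuotient {x} {y} {a} {b} xb≈ya = ∙-cancelʳ (a ∙ b) (x // a) (y // b) (begin
    (x // a) ∙ (a ∙ b)      ≈⟨ sym (assoc (x // a) a b) ⟩
    (x // a) ∙ a ∙ b        ≈⟨ ∙-congʳ (//-rightDividesˡ a x) ⟩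
    x ∙ b                   ≈⟨ xb≈ya ⟩
    y ∙ a                   ≈⟨ ∙-congʳ (sym (//-rightDividesˡ b y)) ⟩
    (y // b) ∙ b ∙ a        ≈⟨ assoc (y // b) b a ⟩
    (y // b) ∙ (b ∙ a)      ≈⟨ ∙-congˡ (comm b a) ⟩
    (y // b) ∙ (a ∙ b)      ∎)

  rescale : ∀ {x a o u v b} c → x ∙ a ∙ o ≈ u ∙ v ∙ b →
            x ∙ c ∙ o ≈ (u // a) ∙ (v // a) ∙ (a ∙ b ∙ c)
  rescale {x} {a} {o} {u} {v} {b} c xao≈uvb = ∙-cancelʳ a _ _ (begin
    x ∙ c ∙ o ∙ a
      ≈⟨ solve 4 (λ x c o a → (((x ⊕ c) ⊕ o) ⊕ a) ⊜ (((x ⊕ a) ⊕ o) ⊕ c)) refl x c o a ⟩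
    x ∙ a ∙ o ∙ c                                 ≈⟨ ∙-congʳ xao≈uvb ⟩
    u ∙ v ∙ b ∙ c                                 ≈⟨ sym (dropUnit (dropUnit refl)) ⟩
    u ∙ v ∙ b ∙ c ∙ (a // a) ∙ (a // a)
      ≈⟨ solve 7 (λ u v b c a A B →
           ((((((u ⊕ v) ⊕ b) ⊕ c) ⊕ (a ⊕ A)) ⊕ (a ⊕ B))
             ⊜ ((((u ⊕ A) ⊕ (v ⊕ B)) ⊕ ((a ⊕ b) ⊕ c)) ⊕ a)))
         refl u v b c a (a ⁻¹) (a ⁻¹) ⟩
    (u // a) ∙ (v // a) ∙ (a ∙ b ∙ c) ∙ a         ∎)
    where
    dropUnit : ∀ {y z} → y ≈ z → y ∙ (a // a) ≈ z
    dropUnit y≈z = trans (∙-congˡ (inverseʳ a)) (trans (identityʳ _) y≈z)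

  solveForPoint : ∀ {x a o e C} → x ∙ a ∙ o ≈ C → o ≈ a ∙ e → x ≈ (C // (o ∙ o)) ∙ e
  solveForPoint {x} {a} {o} {e} {C} xao≈C o≈ae = ∙-cancelʳ (a ∙ o) x _ (begin
    x ∙ (a ∙ o)                     ≈⟨ sym (assoc x a o) ⟩
    x ∙ a ∙ o                       ≈⟨ xao≈C ⟩
    C                               ≈⟨ sym (//-rightDividesˡ (o ∙ o) C) ⟩
    (C // (o ∙ o)) ∙ (o ∙ o)        ≈⟨ ∙-congˡ (∙-congʳ o≈ae) ⟩
    (C // (o ∙ o)) ∙ (a ∙ e ∙ o)    ≈⟨ ∙-congˡ (xy∙z≈y∙xz a e o) ⟩
    (C // (o ∙ o)) ∙ (e ∙ (a ∙ o))  ≈⟨ sym (assoc _ e (a ∙ o)) ⟩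
    (C // (o ∙ o)) ∙ e ∙ (a ∙ o)    ∎)

module _ {c ℓ d : Level} (𝔾 : AbelianGroup c ℓ) (D : AbelianGroup.Carrier 𝔾 → Set d) where
  open AbelianGroup 𝔾
  open GroupFacts 𝔾
  open SetoidReasoning setoid

  On : Carrier → Carrier → Set (c ⊔ ℓ ⊔ d)
  On = OnLine 𝔾 D

  Same : Carrier → Carrier → Set (c ⊔ ℓ ⊔ d)
  Same = SameLine 𝔾 D

  Col₂ : Carrier → Carrier → Set (c ⊔ ℓ ⊔ d)
  Col₂ = Collinear₂ 𝔾 D

  Col₃ : Carrier → Carrier → Carrier → Set (c ⊔ ℓ ⊔ d)
  Col₃ = Collinear₃ 𝔾 D

  onRespPoint : ∀ {x y b} → x ≈ y → On x b → On y b
  onRespPoint x≈y (e , De , x≈be) = e , De , trans (sym x≈y) x≈be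

  onRespLabel : ∀ {x b b′} → b ≈ b′ → On x b → On x b′
  onRespLabel b≈b′ (e , De , x≈be) = e , De , trans x≈be (∙-congʳ b≈b′)

  sameLine : ∀ {b b′} → b ≈ b′ → Same b b′
  sameLine b≈b′ x = onRespLabel b≈b′ , onRespLabel (sym b≈b′)

  OnAway : Carrier → Carrier → Carrier → Set (c ⊔ ℓ ⊔ d)
  OnAway o x a = On x a × ¬ (x ≈ o)

  record TwoLinesThrough (o a b : Carrier) : Set (c ⊔ ℓ ⊔ d) where
    constructor twoLines
    field
      centreOnFirst  : On o a
      centreOnSecond : On o b
      different      : ¬ Same a b

  swapLines : ∀ {o a b} → TwoLinesThrough o a b → TwoLinesThrough o b a
  swapLines (twoLines oa ob a≠b) = twoLines ob oa (λ same → a≠b (λ x → swap (same x)))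

  onLineFromNormalForm : ∀ {q a o C} → q ∙ a ∙ o ≈ C → On o a → On q (C // (o ∙ o))
  onLineFromNormalForm qao≈C (e , De , o≈ae) = e , De , solveForPoint qao≈C o≈ae

  module UniqueLine (qds : IsQuasiDifferenceSet 𝔾 D) where

    labelUnique : ∀ {x y b b′} → On x b → On y b → On x b′ → On y b′ → ¬ x ≈ y → b ≈ b′
    labelUnique (e₁ , De₁ , x≈be₁) (e₂ , De₂ , y≈be₂) (e₁′ , De₁′ , x≈b′e₁′) (e₂′ , De₂′ , y≈b′e₂′) x≉y =
      cancelCoordinate x≈be₁ x≈b′e₁′ e₁≈e₁′
      where
      sameQuotient : e₁ // e₂ ≈ e₁′ // e₂′
      sameQuotient = trans (sym (quotientOnLine x≈be₁ y≈be₂)) (quotientOnLine x≈b′e₁′ y≈b′e₂′)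
      e₁≈e₁′ : e₁ ≈ e₁′
      e₁≈e₁′ with qds e₁ e₂ e₁′ e₂′ De₁ De₂ De₁′ De₂′ (λ q≈ε → x≉y (coincide x≈be₁ y≈be₂ q≈ε)) sameQuotient
      ... | e₁≈e₁′ , _ = e₁≈e₁′

    atMostOneCommonPoint : ∀ {x y z a s} → On x a → On y a → On x s → On y s → On z s → ¬ On z a →
                           ¬ ¬ x ≈ y
    atMostOneCommonPoint xa ya xs ys zs z∉a x≉y = z∉a (onRespLabel (labelUnique xs ys xa ya x≉y) zs)

  module TriangleLaw (four : FourCondition 𝔾 D) where

    triangleLaw : ∀ {P Q R m l} → On P m → On R m → On R l → On Q l → Col₂ P Q → ¬ Col₃ P Q R →
                  P ∙ l ≈ Q ∙ m
    triangleLaw {P} {Q} {R} {m} {l} Pm@(e₁ , De₁ , P≈me₁) Rm@(e₂ , De₂ , R≈me₂)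
                Rl@(f₁ , Df₁ , R≈lf₁) Ql@(f₂ , Df₂ , Q≈lf₂) (n , (g₁ , Dg₁ , P≈ng₁) , (g₂ , Dg₂ , Q≈ng₂))
                notCol = conclude (four e₁ e₂ f₁ f₂ De₁ De₂ Df₁ Df₂ (g₁ , g₂ , Dg₁ , Dg₂ , sidesProduct))
      where
      -- (e₁/e₂)(f₁/f₂) = (P/R)(R/Q) = P/Q = g₁/g₂ lies in DD⁻¹
      sidesProduct : e₁ ∙ e₂ ⁻¹ ∙ f₁ ∙ f₂ ⁻¹ ≈ g₁ // g₂
      sidesProduct = begin
        (e₁ // e₂) ∙ f₁ ∙ f₂ ⁻¹   ≈⟨ assoc (e₁ // e₂) f₁ (f₂ ⁻¹) ⟩
        (e₁ // e₂) ∙ (f₁ // f₂)   ≈⟨ sym (∙-cong (quotientOnLine P≈me₁ R≈me₂) (quotientOnLine R≈lf₁ Q≈lf₂)) ⟩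
        (P // R) ∙ (R // Q)       ≈⟨ telescope P R Q ⟩
        P // Q                    ≈⟨ quotientOnLine P≈ng₁ Q≈ng₂ ⟩
        g₁ // g₂                  ∎

      -- three of the four alternatives make P, Q, R collinear
      conclude : (e₁ // e₂ ≈ ε) ⊎ (f₁ // f₂ ≈ ε) ⊎ (e₁ // f₂ ≈ ε) ⊎ (f₁ // e₂ ≈ ε) → P ∙ l ≈ Q ∙ m
      conclude (inj₁ e₁/e₂≈ε) =
        ⊥-elim (notCol (l , onRespPoint (sym (coincide P≈me₁ R≈me₂ e₁/e₂≈ε)) Rl , Ql , Rl))
      conclude (inj₂ (inj₁ f₁/f₂≈ε)) =
        ⊥-elim (notCol (m , Pm , onRespPoint (coincide R≈lf₁ Q≈lf₂ f₁/f₂≈ε) Rm , Rm))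
      conclude (inj₂ (inj₂ (inj₁ e₁/f₂≈ε))) =
        sameCoordinate (trans P≈me₁ (∙-congˡ (x∙y⁻¹≈ε⇒x≈y e₁ f₂ e₁/f₂≈ε))) Q≈lf₂
      conclude (inj₂ (inj₂ (inj₂ f₁/e₂≈ε))) = ⊥-elim (notCol (l , onRespLabel m≈l Pm , Ql , Rl))
        where
        m≈l : m ≈ l
        m≈l = cancelCoordinate R≈me₂ R≈lf₁ (sym (x∙y⁻¹≈ε⇒x≈y f₁ e₂ f₁/e₂≈ε))

  module Pencil (qds : IsQuasiDifferenceSet 𝔾 D) (four : FourCondition 𝔾 D) where
    open UniqueLine qds
    open TriangleLaw four

    onlyCentreShared : ∀ {o a b x} → TwoLinesThrough o a b → On x a → On x b → ¬ x ≈ o → ⊥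
    onlyCentreShared (twoLines oa ob a≠b) xa xb x≉o = a≠b (sameLine (labelUnique xa oa xb ob x≉o))

    notCollinearWithCentre : ∀ {o a b x y} → TwoLinesThrough o a b → OnAway o x a → OnAway o y b →
                             ¬ Col₃ x o y
    notCollinearWithCentre (twoLines oa ob a≠b) (xa , x≉o) (yb , y≉o) (β , xβ , oβ , yβ) =
      a≠b (sameLine (trans (labelUnique xa oa xβ oβ x≉o) (sym (labelUnique yb ob yβ oβ y≉o))))

    joinThroughCentre : ∀ {o a b x y s} → TwoLinesThrough o a b → OnAway o x a → OnAway o y b →
                        On x s → On y s → x ∙ b ≈ o ∙ s
    joinThroughCentre {a = a} lines@(twoLines oa ob _) x@(xa , _) y@(yb , _) xs ys =
      triangleLaw xs ys yb ob (a , xa , oa) (notCollinearWithCentre lines x y)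

    collinearAcross : ∀ {o a b x y} → TwoLinesThrough o a b → OnAway o x a → OnAway o y b →
                      Col₂ x y → x ∙ b ≈ y ∙ a
    collinearAcross lines x y (s , xs , ys) =
      trans (joinThroughCentre lines x y xs ys) (sym (joinThroughCentre (swapLines lines) y x ys xs))

    meetPoint : ∀ {o a b x′ x″ y′ y″ q} → TwoLinesThrough o a b →
                OnAway o x′ a → OnAway o x″ a → OnAway o y′ b → OnAway o y″ b →
                LinesMeetIn 𝔾 D x′ y′ x″ y″ q → q ∙ a ∙ o ≈ x′ ∙ x″ ∙ b
    meetPoint {o} {a} {b} {x′} {x″} {y′} {y″} {q} lines
              x′↑@(x′a , _) x″↑@(x″a , _) y′↑@(y′b , y′≉o) y″↑@(y″b , y″≉o)
              (s′ , s″ , x′s′ , y′s′ , x″s″ , y″s″ , s′≠s″ , qs′ , qs″) = begin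
      q ∙ a ∙ o       ≈⟨ ∙-congʳ (triangleLaw qs″ x″s″ x″a x′a (s′ , qs′ , x′s′) notCollinear) ⟩
      x′ ∙ s″ ∙ o     ≈⟨ xy∙z≈x∙zy x′ s″ o ⟩
      x′ ∙ (o ∙ s″)   ≈⟨ ∙-congˡ (sym (joinThroughCentre lines x″↑ y″↑ x″s″ y″s″)) ⟩
      x′ ∙ (x″ ∙ b)   ≈⟨ sym (assoc x′ x″ b) ⟩
      x′ ∙ x″ ∙ b     ∎
      where
      offFirstLine : ∀ {y} → On y b → ¬ y ≈ o → ¬ On y a
      offFirstLine yb y≉o ya = onlyCentreShared lines ya yb y≉o

      -- x′ ≈ x″ would force y′ ≈ y″, making the sides x′y′ and x″y″ the same line
      x′≉x″ : ¬ x′ ≈ x″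
      x′≉x″ x′≈x″ = s′≠s″ (sameLine
        (labelUnique x′s′ y′s′ (onRespPoint (sym x′≈x″) x″s″) (onRespPoint (sym y′≈y″) y″s″) x′≉y′))
        where
        y′≈y″ : y′ ≈ y″
        y′≈y″ = ∙-cancelʳ a y′ y″ (begin
          y′ ∙ a   ≈⟨ sym (collinearAcross lines x′↑ y′↑ (s′ , x′s′ , y′s′)) ⟩
          x′ ∙ b   ≈⟨ ∙-congʳ x′≈x″ ⟩
          x″ ∙ b   ≈⟨ collinearAcross lines x″↑ y″↑ (s″ , x″s″ , y″s″) ⟩
          y″ ∙ a   ∎)
        x′≉y′ : ¬ x′ ≈ y′
        x′≉y′ x′≈y′ = offFirstLine y′b y′≉o (onRespPoint x′≈y′ x′a)

      -- on the line a, q would coincide with both x′ and x″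
      notCollinear : ¬ Col₃ q x′ x″
      notCollinear (β , qβ , x′β , x″β) =
        atMostOneCommonPoint qa x′a qs′ x′s′ y′s′ (offFirstLine y′b y′≉o) λ q≈x′ →
        atMostOneCommonPoint qa x″a qs″ x″s″ y″s″ (offFirstLine y″b y″≉o) λ q≈x″ →
        x′≉x″ (trans (sym q≈x′) q≈x″)
        where
        qa : On q a
        qa = onRespLabel (labelUnique x′β x″β x′a x″a x′≉x″) qβ

  module Configuration (qds : IsQuasiDifferenceSet 𝔾 D) (four : FourCondition 𝔾 D)
    (o : Carrier) (L p′ p″ q : Fin 3 → Carrier)
    (distinctLines : ∀ i j → ¬ i ≡ j → ¬ Same (L i) (L j))
    (centreOn : ∀ i → On o (L i))
    (pointsOn : ∀ i → On (p′ i) (L i) × On (p″ i) (L i))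
    (pointsOff : ∀ i → ¬ (p′ i ≈ o) × ¬ (p″ i ≈ o))
    (sidesMeet : ∀ i j k → ¬ i ≡ j → ¬ j ≡ k → ¬ i ≡ k →
                 LinesMeetIn 𝔾 D (p′ i) (p′ j) (p″ i) (p″ j) (q k)) where
    open Pencil qds four

    pencil : ∀ i j → ¬ i ≡ j → TwoLinesThrough o (L i) (L j)
    pencil i j i≢j = twoLines (centreOn i) (centreOn j) (distinctLines i j i≢j)

    p′↑ : ∀ i → OnAway o (p′ i) (L i)
    p′↑ i = proj₁ (pointsOn i) , proj₁ (pointsOff i)

    p″↑ : ∀ i → OnAway o (p″ i) (L i)
    p″↑ i = proj₂ (pointsOn i) , proj₂ (pointsOff i)

    axisEquation : ∀ i j k → ¬ i ≡ j → ¬ j ≡ k → ¬ i ≡ k →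
                   q k ∙ L k ∙ o ≈ (p′ i // L i) ∙ (p″ i // L i) ∙ (L i ∙ L j ∙ L k)
    axisEquation i j k i≢j j≢k i≢k = rescale (L k)
      (meetPoint (pencil i j i≢j) (p′↑ i) (p″↑ i) (p′↑ j) (p″↑ j) (sidesMeet i j k i≢j j≢k i≢k))

    vertexCoordinate′ : ∀ i j → ¬ i ≡ j → Col₂ (p′ i) (p′ j) → p′ i // L i ≈ p′ j // L j
    vertexCoordinate′ i j i≢j col = crossToQuotient (collinearAcross (pencil i j i≢j) (p′↑ i) (p′↑ j) col)

    vertexCoordinate″ : ∀ i j → ¬ i ≡ j → Col₂ (p″ i) (p″ j) → p″ i // L i ≈ p″ j // L j
    vertexCoordinate″ i j i≢j col = crossToQuotient (collinearAcross (pencil i j i≢j) (p″↑ i) (p″↑ j) col)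

pattern one = suc zero
pattern two = suc (suc zero)

proposition4p2 : {c ℓ d : Level} (𝔾 : AbelianGroup c ℓ) (D : AbelianGroup.Carrier 𝔾 → Set d) →
    RespectsEq 𝔾 D → IsQuasiDifferenceSet 𝔾 D → FourCondition 𝔾 D → Desarguesian 𝔾 D
proposition4p2 𝔾 D _ qds four o L p′ p″ q distinctLines centreOn pointsOn pointsOff triangle′ triangle″ sidesMeet =
  (κ′ ∙ κ″ ∙ Λ) // (o ∙ o) , onAxis zero , onAxis one , onAxis two
  where
  open AbelianGroup 𝔾
  open GroupFacts 𝔾
  open Configuration 𝔾 D qds four o L p′ p″ q distinctLines centreOn pointsOn pointsOff sidesMeet

  κ′ κ″ Λ : Carrier
  κ′ = p′ zero // L zero
  κ″ = p″ zero // L zero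
  Λ = L zero ∙ L one ∙ L two

  normalForm : ∀ k → q k ∙ L k ∙ o ≈ κ′ ∙ κ″ ∙ Λ
  normalForm zero = trans (axisEquation one two zero (λ ()) (λ ()) (λ ()))
    (∙-cong (∙-cong (sym (vertexCoordinate′ zero one (λ ()) (proj₁ triangle′)))
                    (sym (vertexCoordinate″ zero one (λ ()) (proj₁ triangle″))))
            (trans (xy∙z≈z∙xy (L one) (L two) (L zero)) (sym (assoc (L zero) (L one) (L two)))))
  normalForm one = trans (axisEquation zero two one (λ ()) (λ ()) (λ ()))
    (∙-congˡ (xy∙z≈xz∙y (L zero) (L two) (L one)))
  normalForm two = axisEquation zero one two (λ ()) (λ ()) (λ ())

  onAxis : ∀ k → OnLine 𝔾 D (q k) ((κ′ ∙ κ″ ∙ Λ) // (o ∙ o))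
  onAxis k = onLineFromNormalForm 𝔾 D (normalForm k) (centreOn k)
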